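{- Let $q$ be a prime power and $v\geq 3$. Then $PG(v,q)$ contains a $v$-fold strong blocking set of size $$(q-1)\left(\frac{v(v+1)}{2}-2\right)+v+5.$$
   Context: For $2\leq t\leq v$, a point set $B$ in $PG(v,q)$ is a $t$-fold strong blocking set if every $(t-1)$-dimensional subspace of $PG(v,q)$ is spanned by $t$ points of $B$. In particular a $v$-fold strong blocking set is one such that every hyperplane is spanned by $v$ of its points. -}

module Defs where

open import Level using (Level; _⊔_) renaming (suc to lsuc)
open import Algebra.Bundles using (CommutativeRing)
open import Data.Nat using (ℕ; zero; suc; _^_; _≤_)
import Data.Nat as ℕ
open import Data.Nat.Primality using (Prime)
open import Data.Fin using (Fin; zero; suc)
open import Data.Product using (Σ; ∃; _×_; _,_)
open import Relation.Nullary using (¬_)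
open import Relation.Binary.PropositionalEquality using (_≡_; _≢_)

PrimePower : ℕ → Set
PrimePower q = Σ ℕ λ p → Σ ℕ λ k → Prime p × 1 ≤ k × q ≡ p ^ k

record FiniteField (c ℓ : Level) (q : ℕ) : Set (lsuc (c ⊔ ℓ)) where
  field
    commRing : CommutativeRing c ℓ
  open CommutativeRing commRing public
  field
    0≉1      : ¬ (0# ≈ 1#)
    inverse  : ∀ x → ¬ (x ≈ 0#) → ∃ λ y → x * y ≈ 1#
    enum     : Fin q → Carrier
    enum-surj : ∀ x → ∃ λ i → x ≈ enum i
    enum-inj  : ∀ i j → enum i ≈ enum j → i ≡ j

-- Projective geometry PG(v,q) over a finite field F: points are nonzero
-- vectors of F^(v+1) up to nonzero scalars.
module PG {c ℓ : Level} {q : ℕ} (F : FiniteField c ℓ q) (v : ℕ) where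
  open FiniteField F using (Carrier; _≈_; _+_; _*_; 0#; 1#)

  Vect : Set c
  Vect = Fin (suc v) → Carrier

  Σ⟨_⟩ : ∀ {n} → (Fin n → Carrier) → Carrier
  Σ⟨_⟩ {zero}  f = 0#
  Σ⟨_⟩ {suc n} f = f zero + Σ⟨ (λ i → f (suc i)) ⟩

  IsZero : Vect → Set ℓ
  IsZero x = ∀ i → x i ≈ 0#

  Proportional : Vect → Vect → Set (c ⊔ ℓ)
  Proportional x y = ∃ λ λ₀ → ∀ i → x i ≈ λ₀ * y i

  record PointSet (N : ℕ) : Set (c ⊔ ℓ) where
    field
      pt       : Fin N → Vect
      nonzero  : ∀ k → ¬ IsZero (pt k)
      distinct : ∀ k l → k ≢ l → ¬ Proportional (pt k) (pt l)

  InHyperplane : Vect → Vect → Set ℓ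
  InHyperplane a x = Σ⟨ (λ i → a i * x i) ⟩ ≈ 0#

  InSpan : ∀ {m} → (Fin m → Vect) → Vect → Set (c ⊔ ℓ)
  InSpan {m} w x = ∃ λ (coef : Fin m → Carrier) →
    ∀ i → x i ≈ Σ⟨ (λ j → coef j * w j i) ⟩

  IsVFoldStrongBlockingSet : ∀ {N} → PointSet N → Set (c ⊔ ℓ)
  IsVFoldStrongBlockingSet {N} B =
    ∀ (a : Vect) → ¬ IsZero a →
      ∃ λ (sel : Fin v → Fin N) →
        (∀ j → InHyperplane a (PointSet.pt B (sel j))) ×
        (∀ x → InHyperplane a x → InSpan (λ j → PointSet.pt B (sel j)) x)

blockingSize : ℕ → ℕ → ℕ
blockingSize q v = (q ℕ.∸ 1) ℕ.* (((v ℕ.* suc v) ℕ./ 2) ℕ.∸ 2) ℕ.+ v ℕ.+ 5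

-- By induction on v ≥ 3.  In PG(3,q) take the 4(q+1) points of four pairwise skew lines: the
-- coordinate lines x₂ = x₃ = 0 and x₀ = x₁ = 0, the diagonal {(p, p)} and the twisted line
-- {(p, M p)}, where M is a 2×2 matrix without eigenvalues.  A hyperplane (A, B) either contains
-- a coordinate line, or meets both in points P, P′; then the diagonal (if det (A, B) ≠ 0) or
-- the twisted line (if A ∥ B) supplies a third point of the hyperplane outside ⟨P, P′⟩.
-- From PG(v,q) to PG(v+1,q), put the old set into x₀ = 0 and add e₀ and the (v+1)(q-1) points
-- e₀ + μ eⱼ, μ ≠ 0.  A hyperplane with a₀ = 0 is spanned by e₀ and old points; one with a₀ ≠ 0
-- is the graph of a linear form, and its natural basis vectors are, up to scalars, new points
-- or old basis points.

module Submission where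

open import Defs
open import Level using (Level; _⊔_)
open import Data.Nat as Nat using (ℕ; zero; suc; _∸_; _/_; _≤_; z≤n; s≤s)
open import Data.Nat.Properties as ℕP using (+-∸-comm; m≤n+m)
open import Data.Nat.DivMod using (+-distrib-/-∣ʳ; m*n/n≡m)
open import Data.Nat.Divisibility using (divides-refl)
open import Data.Nat.Tactic.RingSolver using (solve-∀)
open import Algebra.Bundles using (CommutativeRing; RawRing)
open import Data.Empty using (⊥-elim)
open import Data.Fin using (Fin; zero; suc)
open import Data.Product using (Σ; ∃; _×_; _,_; proj₁; proj₂; uncurry)
import Data.Product.Properties as ×P
open import Data.Maybe using (Maybe; just; nothing)
open import Relation.Nullary using (¬_; Dec; yes; no)
open import Data.Vec.Functional using (Vector; tail; _∷_; [])
open import Relation.Binary.PropositionalEquality as ≡ using (_≡_; _≢_)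

module BlockingSizeArithmetic where
  open Nat using (_+_; _*_)
  open ≡.≡-Reasoning

  half-pronic-suc : ∀ n → (suc n * suc (suc n)) / 2 ≡ (n * suc n) / 2 + suc n
  half-pronic-suc n = begin
    (suc n * suc (suc n)) / 2          ≡⟨ ≡.cong (_/ 2) (pronic-suc n) ⟩
    (n * suc n + suc n * 2) / 2        ≡⟨ +-distrib-/-∣ʳ (n * suc n) (divides-refl (suc n)) ⟩
    (n * suc n) / 2 + (suc n * 2) / 2  ≡⟨ ≡.cong ((n * suc n) / 2 +_) (m*n/n≡m (suc n) 2) ⟩
    (n * suc n) / 2 + suc n            ∎
    where
    pronic-suc : ∀ n → suc n * suc (suc n) ≡ n * suc n + suc n * 2
    pronic-suc = solve-∀

  blockingSize-3 : ∀ r → blockingSize (suc r) 3 ≡ 4 * (2 + r)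
  blockingSize-3 r = lemma r
    where
    lemma : ∀ r → r * 4 + 3 + 5 ≡ 4 * (2 + r)
    lemma = solve-∀

  blockingSize-suc : ∀ r m →
    blockingSize (suc r) (4 + m) ≡ blockingSize (suc r) (3 + m) + suc ((4 + m) * r)
  blockingSize-suc r m = begin
    blockingSize (suc r) (4 + m)           ≡⟨ ≡.cong (λ t → r * (t ∸ 2) + (4 + m) + 5) (half-pronic-suc (3 + m)) ⟩
    r * ((T + (4 + m)) ∸ 2) + (4 + m) + 5  ≡⟨ ≡.cong (λ t → r * t + (4 + m) + 5) (+-∸-comm (4 + m) 2≤T) ⟩
    r * ((T ∸ 2) + (4 + m)) + (4 + m) + 5  ≡⟨ regroup r m (T ∸ 2) ⟩
    r * (T ∸ 2) + (3 + m) + 5 + suc ((4 + m) * r) ∎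
    where
    T = ((3 + m) * (4 + m)) / 2
    2≤T : 2 ≤ T
    2≤T = ≡.subst (2 ≤_) (≡.sym (half-pronic-suc (2 + m))) (ℕP.≤-trans (s≤s (s≤s z≤n)) (m≤n+m (3 + m) _))
    regroup : ∀ r m s → r * (s + (4 + m)) + (4 + m) + 5 ≡ r * s + (3 + m) + 5 + suc ((4 + m) * r)
    regroup = solve-∀

module FinLemmas where
  open import Data.Fin using (punchOut; splitAt; join; remQuot; combine)
  open import Data.Fin.Properties
    using (_≟_; any?; ¬∀⟶∃¬; pigeonhole; punchOut-injective; <-irrefl; join-splitAt; combine-remQuot)
  open ≡.≡-Reasoning

  splitAt-injective : ∀ m {n} {k l : Fin (m Nat.+ n)} → splitAt m k ≡ splitAt m l → k ≡ l
  splitAt-injective m {n} {k} {l} eq = begin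
    k                      ≡⟨ join-splitAt m n k ⟨
    join m n (splitAt m k) ≡⟨ ≡.cong (join m n) eq ⟩
    join m n (splitAt m l) ≡⟨ join-splitAt m n l ⟩
    l                      ∎

  remQuot-injective : ∀ {m} n {k l : Fin (m Nat.* n)} → remQuot {m} n k ≡ remQuot n l → k ≡ l
  remQuot-injective {m} n {k} {l} eq = begin
    k                                   ≡⟨ combine-remQuot {m} n k ⟨
    uncurry combine (remQuot {m} n k)   ≡⟨ ≡.cong (uncurry combine) eq ⟩
    uncurry combine (remQuot {m} n l)   ≡⟨ combine-remQuot {m} n l ⟩
    l                                   ∎


  collision⇒missedValue : ∀ {n} (f : Fin (suc n) → Fin (suc n)) {i j : Fin (suc n)} →
    i ≢ j → f i ≡ f j → ∃ λ y → ∀ x → f x ≢ y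
  collision⇒missedValue {n} f {i} {j} i≢j fi≡fj =
    let y , missed = ¬∀⟶∃¬ _ (λ y → ∃ λ x → f x ≡ y) (λ y → any? λ x → f x ≟ y) notSurjective
    in y , λ x fx≡y → missed (x , fx≡y)
    where
    module _ (surj : ∀ y → ∃ λ x → f x ≡ y) where
      preimage : ∀ y → Σ (Fin (suc n)) λ x → f x ≡ y × j ≢ x
      preimage y with surj y
      ... | x , fx≡y with x ≟ j
      ...   | yes ≡.refl = i , ≡.trans fi≡fj fx≡y , λ j≡i → i≢j (≡.sym j≡i)
      ...   | no x≢j     = x , fx≡y , λ j≡x → x≢j (≡.sym j≡x)

      -- Preimages avoid j, so punching j out leaves an injection Fin (suc n) → Fin n.
      section : Fin (suc n) → Fin n
      section y = punchOut (proj₂ (proj₂ (preimage y)))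

      section-injective : ∀ y y′ → section y ≡ section y′ → y ≡ y′
      section-injective y y′ eq = begin
        y                      ≡⟨ ≡.sym (proj₁ (proj₂ (preimage y))) ⟩
        f (proj₁ (preimage y))  ≡⟨ ≡.cong f (punchOut-injective (proj₂ (proj₂ (preimage y))) (proj₂ (proj₂ (preimage y′))) eq) ⟩
        f (proj₁ (preimage y′)) ≡⟨ proj₁ (proj₂ (preimage y′)) ⟩
        y′                     ∎

    notSurjective : ¬ (∀ y → ∃ λ x → f x ≡ y)
    notSurjective surj =
      let y , y′ , y<y′ , same = pigeonhole (ℕP.n<1+n n) (section surj)
      in <-irrefl (section-injective surj y y′ same) y<y′

-- The ring solver for an arbitrary commutative ring, with integer coefficients m - n stored
-- as normalised pairs (m , n), so that equal coefficients are syntactically equal and normal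
-- forms can be compared by refl.
module IntegerCoefficientSolver {c ℓ} (R : CommutativeRing c ℓ) where
  open CommutativeRing R
  open import Algebra.Properties.Ring ring using (-‿involutive; -‿distribˡ-*; -‿distribʳ-*; -0#≈0#; -‿+-comm)
  open import Algebra.Properties.Semiring.Mult semiring using (×1-homo-*; ×-homo-+) renaming (_×_ to _×ᵣ_)
  open import Algebra.Properties.CommutativeSemigroup +-commutativeSemigroup using (interchange)
  open import Algebra.Solver.Ring.AlmostCommutativeRing
    using (fromCommutativeRing; _-Raw-AlmostCommutative⟶_)
  open import Relation.Binary.Reasoning.Setoid setoid

  private
    normalise : ℕ × ℕ → ℕ × ℕ
    normalise (m , n) = m ∸ n , n ∸ m

    integers : RawRing _ _
    integers = record
      { Carrier = ℕ × ℕ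
      ; _≈_     = _≡_
      ; _+_     = λ { (m , n) (m′ , n′) → normalise (m Nat.+ m′ , n Nat.+ n′) }
      ; _*_     = λ { (m , n) (m′ , n′) → normalise (m Nat.* m′ Nat.+ n Nat.* n′ , m Nat.* n′ Nat.+ n Nat.* m′) }
      ; -_      = λ { (m , n) → n , m }
      ; 0#      = 0 , 0
      ; 1#      = 1 , 0
      }

    ⟦_⟧ : ℕ × ℕ → Carrier
    ⟦ m , n ⟧ = m ×ᵣ 1# + - (n ×ᵣ 1#)

    [z+x]-[z+y]≈x-y : ∀ x y z → (z + x) + - (z + y) ≈ x + - y
    [z+x]-[z+y]≈x-y x y z = begin
      (z + x) + - (z + y)    ≈⟨ +-congˡ (-‿+-comm z y) ⟨
      (z + x) + (- z + - y)  ≈⟨ interchange z x (- z) (- y) ⟩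
      (z + - z) + (x + - y)  ≈⟨ +-congʳ (-‿inverseʳ z) ⟩
      0# + (x + - y)         ≈⟨ +-identityˡ _ ⟩
      x + - y                ∎

    ⟦normalise⟧ : ∀ m n → ⟦ normalise (m , n) ⟧ ≈ ⟦ m , n ⟧
    ⟦normalise⟧ zero    zero    = refl
    ⟦normalise⟧ zero    (suc n) = refl
    ⟦normalise⟧ (suc m) zero    = refl
    ⟦normalise⟧ (suc m) (suc n) = trans (⟦normalise⟧ m n) (sym ([z+x]-[z+y]≈x-y _ _ 1#))

    [a-b][c-d] : ∀ a b c d → (a * c + b * d) + - (a * d + b * c) ≈ (a + - b) * (c + - d)
    [a-b][c-d] a b c d = sym (begin
      (a + - b) * (c + - d)                     ≈⟨ distribʳ _ _ _ ⟩
      a * (c + - d) + - b * (c + - d)           ≈⟨ +-cong (distribˡ _ _ _) (distribˡ _ _ _) ⟩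
      (a * c + a * - d) + (- b * c + - b * - d) ≈⟨ +-cong (+-congˡ (sym (-‿distribʳ-* a d))) (+-cong (sym (-‿distribˡ-* b c)) neg-neg) ⟩
      (a * c + - (a * d)) + (- (b * c) + b * d) ≈⟨ +-congˡ (+-comm _ _) ⟩
      (a * c + - (a * d)) + (b * d + - (b * c)) ≈⟨ interchange _ _ _ _ ⟩
      (a * c + b * d) + (- (a * d) + - (b * c)) ≈⟨ +-congˡ (-‿+-comm _ _) ⟩
      (a * c + b * d) + - (a * d + b * c)       ∎)
      where
      neg-neg : - b * - d ≈ b * d
      neg-neg = trans (sym (-‿distribˡ-* b (- d))) (trans (-‿cong (sym (-‿distribʳ-* b d))) (-‿involutive _))

    homomorphism : integers -Raw-AlmostCommutative⟶ fromCommutativeRing R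
    homomorphism = record
      { ⟦_⟧    = ⟦_⟧
      ; +-homo = λ { (m , n) (m′ , n′) → begin
          ⟦ normalise (m Nat.+ m′ , n Nat.+ n′) ⟧                  ≈⟨ ⟦normalise⟧ (m Nat.+ m′) (n Nat.+ n′) ⟩
          (m Nat.+ m′) ×ᵣ 1# + - ((n Nat.+ n′) ×ᵣ 1#)              ≈⟨ +-cong (×-homo-+ 1# m m′) (-‿cong (×-homo-+ 1# n n′)) ⟩
          (m ×ᵣ 1# + m′ ×ᵣ 1#) + - (n ×ᵣ 1# + n′ ×ᵣ 1#)           ≈⟨ +-congˡ (-‿+-comm _ _) ⟨
          (m ×ᵣ 1# + m′ ×ᵣ 1#) + (- (n ×ᵣ 1#) + - (n′ ×ᵣ 1#))     ≈⟨ interchange _ _ _ _ ⟩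
          ⟦ m , n ⟧ + ⟦ m′ , n′ ⟧                                  ∎ }
      ; *-homo = λ { (m , n) (m′ , n′) → begin
          ⟦ normalise (m Nat.* m′ Nat.+ n Nat.* n′ , m Nat.* n′ Nat.+ n Nat.* m′) ⟧
            ≈⟨ ⟦normalise⟧ (m Nat.* m′ Nat.+ n Nat.* n′) (m Nat.* n′ Nat.+ n Nat.* m′) ⟩
          (m Nat.* m′ Nat.+ n Nat.* n′) ×ᵣ 1# + - ((m Nat.* n′ Nat.+ n Nat.* m′) ×ᵣ 1#)
            ≈⟨ +-cong (bilinear m m′ n n′) (-‿cong (bilinear m n′ n m′)) ⟩
          (m ×ᵣ 1# * m′ ×ᵣ 1# + n ×ᵣ 1# * n′ ×ᵣ 1#) + - (m ×ᵣ 1# * n′ ×ᵣ 1# + n ×ᵣ 1# * m′ ×ᵣ 1#)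
            ≈⟨ [a-b][c-d] _ _ _ _ ⟩
          ⟦ m , n ⟧ * ⟦ m′ , n′ ⟧ ∎ }
      ; -‿homo = λ { (m , n) → begin
          n ×ᵣ 1# + - (m ×ᵣ 1#)        ≈⟨ +-comm _ _ ⟩
          - (m ×ᵣ 1#) + n ×ᵣ 1#        ≈⟨ +-congˡ (-‿involutive _) ⟨
          - (m ×ᵣ 1#) + - - (n ×ᵣ 1#)  ≈⟨ -‿+-comm _ _ ⟩
          - ⟦ m , n ⟧                  ∎ }
      ; 0-homo = trans (+-identityˡ _) -0#≈0#
      ; 1-homo = trans (+-congˡ -0#≈0#) (trans (+-identityʳ _) (+-identityʳ _))
      }
      where
      bilinear : ∀ a b c d → (a Nat.* b Nat.+ c Nat.* d) ×ᵣ 1# ≈ a ×ᵣ 1# * b ×ᵣ 1# + c ×ᵣ 1# * d ×ᵣ 1#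
      bilinear a b c d = trans (×-homo-+ 1# (a Nat.* b) (c Nat.* d)) (+-cong (×1-homo-* a b) (×1-homo-* c d))

    dec : ∀ x y → Maybe (⟦ x ⟧ ≈ ⟦ y ⟧)
    dec x y with ×P.≡-dec ℕP._≟_ ℕP._≟_ x y
    ... | yes ≡.refl = just refl
    ... | no _       = nothing

  open import Algebra.Solver.Ring integers (fromCommutativeRing R) homomorphism dec public
    using (solve; _:+_; _:*_; :-_; _:=_)

module Coordinates {c ℓ} (R : CommutativeRing c ℓ) where
  open CommutativeRing R hiding (zero)
  open import Algebra.Properties.Semiring.Sum semiring public using (sum; sum-cong-≋; *-distribˡ-sum; ∑-distrib-+)
  open import Data.Vec.Functional.Relation.Binary.Equality.Setoid setoid public
    using (_≋_; ≋-refl; ≋-reflexive; ≋-sym; ≋-trans)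
  open import Algebra.Properties.Ring ring using (-0#≈0#)
  open IntegerCoefficientSolver R using (solve; _:+_; _:*_; :-_; _:=_)
  open import Relation.Binary.Reasoning.Setoid setoid

  infix 8 _⋆_
  infix 7 _·_

  _⋆_ : ∀ {n} → Carrier → Vector Carrier n → Vector Carrier n
  s ⋆ x = λ i → s * x i

  _·_ : ∀ {n} → Vector Carrier n → Vector Carrier n → Carrier
  a · x = sum λ i → a i * x i

  IsZero : ∀ {n} → Vector Carrier n → Set ℓ
  IsZero x = ∀ i → x i ≈ 0#

  Proportional : ∀ {n} → Vector Carrier n → Vector Carrier n → Set (c ⊔ ℓ)
  Proportional x y = ∃ λ μ → x ≋ μ ⋆ y

  InSpan : ∀ {m n} → (Fin m → Vector Carrier n) → Vector Carrier n → Set (c ⊔ ℓ)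
  InSpan w x = ∃ λ (coef : Vector Carrier _) → ∀ i → x i ≈ sum (λ j → coef j * w j i)

  record SpansHyperplane {m n} (a : Vector Carrier n) (w : Fin m → Vector Carrier n) : Set (c ⊔ ℓ) where
    constructor spansHyperplane
    field
      inHyperplane : ∀ j → a · w j ≈ 0#
      spans        : ∀ x → a · x ≈ 0# → InSpan w x

  basis : ∀ {n} → Fin n → Vector Carrier n
  basis zero    zero    = 1#
  basis zero    (suc j) = 0#
  basis (suc i) zero    = 0#
  basis (suc i) (suc j) = basis i j

  basis-diag : ∀ {n} (i : Fin n) → basis i i ≈ 1#
  basis-diag zero    = refl
  basis-diag (suc i) = basis-diag i

  basis-off : ∀ {n} {i j : Fin n} → i ≢ j → basis i j ≈ 0#
  basis-off {i = zero}  {zero}  i≢j = ⊥-elim (i≢j ≡.refl)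
  basis-off {i = zero}  {suc j} _   = refl
  basis-off {i = suc i} {zero}  _   = refl
  basis-off {i = suc i} {suc j} i≢j = basis-off (λ i≡j → i≢j (≡.cong suc i≡j))

  sum-zero : ∀ {n} (f : Vector Carrier n) → IsZero f → sum f ≈ 0#
  sum-zero {zero}  _ _  = refl
  sum-zero {suc n} f f0 = trans (+-cong (f0 zero) (sum-zero (tail f) (λ i → f0 (suc i)))) (+-identityʳ 0#)

  ·-basisʳ : ∀ {n} (a : Vector Carrier n) j → a · basis j ≈ a j
  ·-basisʳ a zero = begin
    a zero * 1# + sum (λ i → a (suc i) * 0#) ≈⟨ +-cong (*-identityʳ _) (sum-zero (λ i → a (suc i) * 0#) (λ i → zeroʳ _)) ⟩
    a zero + 0#                              ≈⟨ +-identityʳ _ ⟩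
    a zero                                   ∎
  ·-basisʳ a (suc j) = begin
    a zero * 0# + (tail a · basis j) ≈⟨ +-cong (zeroʳ _) (·-basisʳ (tail a) j) ⟩
    0# + a (suc j)                   ≈⟨ +-identityˡ _ ⟩
    a (suc j)                        ∎

  sum-basis : ∀ {n} (x : Vector Carrier n) i → sum (λ j → x j * basis j i) ≈ x i
  sum-basis x zero = ·-basisʳ x zero
  sum-basis x (suc i) = begin
    x zero * 0# + sum (λ j → x (suc j) * basis j i) ≈⟨ +-cong (zeroʳ _) (sum-basis (tail x) i) ⟩
    0# + x (suc i)                                  ≈⟨ +-identityˡ _ ⟩
    x (suc i)                                       ∎

  ·-zeroʳ : ∀ {n} (a : Vector Carrier n) → a · (λ _ → 0#) ≈ 0#
  ·-zeroʳ a = sum-zero (λ i → a i * 0#) (λ i → zeroʳ (a i))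

  ·-distribʳ-+ : ∀ {n} (a b x : Vector Carrier n) → (λ i → a i + b i) · x ≈ a · x + b · x
  ·-distribʳ-+ a b x = trans (sum-cong-≋ (λ i → distribʳ (x i) (a i) (b i))) (∑-distrib-+ (λ i → a i * x i) (λ i → b i * x i))

  ·-comm : ∀ {n} (a x : Vector Carrier n) → a · x ≈ x · a
  ·-comm a x = sum-cong-≋ (λ i → *-comm (a i) (x i))

  ·-congʳ : ∀ {n} (a : Vector Carrier n) {x y} → x ≋ y → a · x ≈ a · y
  ·-congʳ a x≋y = sum-cong-≋ (λ i → *-congˡ (x≋y i))

  ·-⋆ʳ : ∀ {n} (a : Vector Carrier n) s x → a · (s ⋆ x) ≈ s * (a · x)
  ·-⋆ʳ a s x = begin
    sum (λ i → a i * (s * x i)) ≈⟨ sum-cong-≋ (λ i → x∙yz≈y∙xz (a i) s (x i)) ⟩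
    sum (λ i → s * (a i * x i)) ≈⟨ *-distribˡ-sum s (λ i → a i * x i) ⟨
    s * (a · x)                 ∎
    where open import Algebra.Properties.CommutativeSemigroup *-commutativeSemigroup using (x∙yz≈y∙xz)

  ·-zeroˡ : ∀ {n} {a : Vector Carrier n} x → IsZero a → a · x ≈ 0#
  ·-zeroˡ {a = a} x a≈0 = sum-zero (λ i → a i * x i) (λ i → trans (*-congʳ (a≈0 i)) (zeroˡ (x i)))

  InSpan₃ : ∀ {n} {u v w x : Vector Carrier n} α β γ →
    (∀ i → x i ≈ α * u i + (β * v i + γ * w i)) → InSpan (u ∷ v ∷ w ∷ []) x
  InSpan₃ α β γ x≈ = α ∷ β ∷ γ ∷ [] , λ i → trans (x≈ i) (+-congˡ (+-congˡ (sym (+-identityʳ _))))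

  ·-linearʳ : ∀ {n} (a x w : Vector Carrier n) γ → a · (λ i → x i + - (γ * w i)) ≈ a · x + - (γ * (a · w))
  ·-linearʳ {zero}  a x w γ = sym (trans (+-congˡ (trans (-‿cong (zeroʳ γ)) -0#≈0#)) (+-identityʳ 0#))
  ·-linearʳ {suc n} a x w γ = begin
    a zero * (x zero + - (γ * w zero)) + tail a · (λ i → x (suc i) + - (γ * w (suc i)))
      ≈⟨ +-congˡ (·-linearʳ (tail a) (tail x) (tail w) γ) ⟩
    a zero * (x zero + - (γ * w zero)) + (tail a · tail x + - (γ * (tail a · tail w)))

        ≈⟨ identity (a zero) (x zero) (w zero) γ (tail a · tail x) (tail a · tail w) ⟩
    a · x + - (γ * (a · w)) ∎
    where
    identity : ∀ a₀ x₀ w₀ γ s t →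
      a₀ * (x₀ + - (γ * w₀)) + (s + - (γ * t)) ≈ (a₀ * x₀ + s) + - (γ * (a₀ * w₀ + t))
    identity = solve 6 (λ a₀ x₀ w₀ γ s t →
      a₀ :* (x₀ :+ :- (γ :* w₀)) :+ (s :+ :- (γ :* t)) := (a₀ :* x₀ :+ s) :+ :- (γ :* (a₀ :* w₀ :+ t))) refl

  InSpan-rescale : ∀ {m n} {w w′ : Fin m → Vector Carrier n} {x} (s : Vector Carrier m) →
    (∀ j → w j ≋ s j ⋆ w′ j) → InSpan w x → InSpan w′ x
  InSpan-rescale s w≋sw′ (coef , x≈) = (λ j → coef j * s j) , λ i →
    trans (x≈ i) (sum-cong-≋ λ j → trans (*-congˡ (w≋sw′ j i)) (sym (*-assoc _ _ _)))

  SpansHyperplane-cong : ∀ {m n} {a} {w w′ : Fin m → Vector Carrier n} →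
    SpansHyperplane a w → (∀ j → w j ≋ w′ j) → SpansHyperplane a w′
  SpansHyperplane-cong {a = a} (spansHyperplane aw≈0 span) w≋w′ = spansHyperplane
    (λ j → trans (sym (·-congʳ a (w≋w′ j))) (aw≈0 j))
    (λ x ax≈0 → InSpan-rescale (λ _ → 1#) (λ j i → trans (w≋w′ j i) (sym (*-identityˡ _))) (span x ax≈0))

  SpansHyperplane-axis : ∀ {m n} {a : Vector Carrier (suc n)} {w : Fin m → Vector Carrier n} →
    a zero ≈ 0# → SpansHyperplane (tail a) w → SpansHyperplane a (basis zero ∷ λ j → 0# ∷ w j)
  SpansHyperplane-axis {a = a} {w} a₀≈0 (spansHyperplane aw≈0 span) = spansHyperplane inHyperplane spanned
    where
    inHyperplane : ∀ j → a · (basis zero ∷ λ j → 0# ∷ w j) j ≈ 0#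
    inHyperplane zero    = trans (·-basisʳ a zero) a₀≈0
    inHyperplane (suc j) = trans (+-cong (zeroʳ (a zero)) (aw≈0 j)) (+-identityʳ 0#)
    spanned : ∀ x → a · x ≈ 0# → InSpan (basis zero ∷ λ j → 0# ∷ w j) x
    spanned x ax≈0 =
      let coef , x≈ = span (tail x) (trans (sym (+-identityˡ _)) (trans (+-congʳ (sym (trans (*-congʳ a₀≈0) (zeroˡ _)))) ax≈0))
      in x zero ∷ coef , λ
        { zero    → sym (begin
            x zero * 1# + sum (λ j → coef j * 0#) ≈⟨ +-cong (*-identityʳ _) (sum-zero _ (λ j → zeroʳ (coef j))) ⟩
            x zero + 0#                            ≈⟨ +-identityʳ _ ⟩
            x zero                                 ∎)
        ; (suc i) → trans (x≈ i) (sym (trans (+-congʳ (zeroʳ (x zero))) (+-identityˡ _))) }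

module FiniteFieldFacts {c ℓ r} (F : FiniteField c ℓ (suc r)) where
  open FiniteField F hiding (zero)
  open Coordinates commRing public
  open import Algebra.Properties.Ring ring public using (-‿involutive; -0#≈0#; -‿distribʳ-*)
  open import Algebra.Properties.AbelianGroup +-abelianGroup public using (inverseˡ-unique)
  open import Relation.Binary.Reasoning.Setoid setoid
  open import Data.Fin using (punchIn; punchOut)
  open import Data.Fin.Properties as FinP using ()
  open import Relation.Binary.Definitions using (Decidable)

  _≟_ : Decidable _≈_
  x ≟ y with enum-surj x | enum-surj y
  ... | i , x≈i | j , y≈j with i FinP.≟ j
  ...   | yes ≡.refl = yes (trans x≈i (sym y≈j))
  ...   | no i≢j     = no λ x≈y → i≢j (enum-inj i j (trans (sym x≈i) (trans x≈y y≈j)))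

  open IntegerCoefficientSolver commRing public using (solve; _:+_; _:*_; :-_; _:=_)

  1≉0 : 1# ≉ 0#
  1≉0 1≈0 = 0≉1 (sym 1≈0)

  inv : ∀ x → x ≉ 0# → Carrier
  inv x x≉0 = proj₁ (inverse x x≉0)

  *-inverseʳ : ∀ x (x≉0 : x ≉ 0#) → x * inv x x≉0 ≈ 1#
  *-inverseʳ x x≉0 = proj₂ (inverse x x≉0)

  *-inverseˡ : ∀ x (x≉0 : x ≉ 0#) → inv x x≉0 * x ≈ 1#
  *-inverseˡ x x≉0 = trans (*-comm _ _) (*-inverseʳ x x≉0)

  *-cancelˡ : ∀ {m x y} → m ≉ 0# → m * x ≈ m * y → x ≈ y
  *-cancelˡ {m} {x} {y} m≉0 mx≈my = begin
    x                  ≈⟨ unscale x ⟨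
    (inv m m≉0 * m) * x ≈⟨ *-assoc _ _ _ ⟩
    inv m m≉0 * (m * x) ≈⟨ *-congˡ mx≈my ⟩
    inv m m≉0 * (m * y) ≈⟨ *-assoc _ _ _ ⟨
    (inv m m≉0 * m) * y ≈⟨ unscale y ⟩
    y                  ∎
    where
    unscale : ∀ z → (inv m m≉0 * m) * z ≈ z
    unscale z = trans (*-congʳ (*-inverseˡ m m≉0)) (*-identityˡ z)

  inv-≉0 : ∀ x (x≉0 : x ≉ 0#) → inv x x≉0 ≉ 0#
  inv-≉0 x x≉0 inv≈0 = 1≉0 (trans (sym (*-inverseʳ x x≉0)) (trans (*-congˡ inv≈0) (zeroʳ x)))

  -‿≉0 : ∀ {x} → x ≉ 0# → - x ≉ 0#
  -‿≉0 {x} x≉0 -x≈0 = x≉0 (trans (sym (-‿involutive x)) (trans (-‿cong -x≈0) -0#≈0#))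

  x*y≈0⇒y≈0 : ∀ {x y} → x * y ≈ 0# → x ≉ 0# → y ≈ 0#
  x*y≈0⇒y≈0 {x} xy≈0 x≉0 = *-cancelˡ x≉0 (trans xy≈0 (sym (zeroʳ x)))

  *-nonzero : ∀ {x y} → x ≉ 0# → y ≉ 0# → x * y ≉ 0#
  *-nonzero x≉0 y≉0 xy≈0 = y≉0 (x*y≈0⇒y≈0 xy≈0 x≉0)

  zeroIndex : Fin (suc r)
  zeroIndex = proj₁ (enum-surj 0#)

  nonzeroElem : Fin r → Carrier
  nonzeroElem i = enum (punchIn zeroIndex i)

  nonzeroElem-≉0 : ∀ i → nonzeroElem i ≉ 0#
  nonzeroElem-≉0 i ≈0 = FinP.punchInᵢ≢i zeroIndex i (enum-inj _ _ (trans ≈0 (proj₂ (enum-surj 0#))))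

  nonzeroElem-injective : ∀ {i j} → nonzeroElem i ≈ nonzeroElem j → i ≡ j
  nonzeroElem-injective {i} {j} eq = FinP.punchIn-injective zeroIndex i j (enum-inj _ _ eq)

  nonzeroElem-surjective : ∀ x → x ≉ 0# → ∃ λ i → x ≈ nonzeroElem i
  nonzeroElem-surjective x x≉0 with enum-surj x
  ... | k , x≈k with zeroIndex FinP.≟ k
  ...   | yes ≡.refl = ⊥-elim (x≉0 (trans x≈k (sym (proj₂ (enum-surj 0#)))))
  ...   | no 0≢k     = punchOut 0≢k , trans x≈k (reflexive (≡.cong enum (≡.sym (FinP.punchIn-punchOut 0≢k))))

  -- Since t² - t takes the value 0 twice, it misses some value.
  ∃-nonvalue-t²-t : ∃ λ κ → ∀ t → t * t + - t ≉ κ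
  ∃-nonvalue-t²-t =
    let y , missed = collision⇒missedValue index 0≢1 (enum-inj _ _ g0≈g1)
    in enum y , λ t gt≈y →
      let k , t≈k = enum-surj t
      in missed k (enum-inj _ _ (trans (sym (index-spec k)) (trans (g-cong (sym t≈k)) gt≈y)))
    where
    open FinLemmas using (collision⇒missedValue)
    g : Carrier → Carrier
    g t = t * t + - t
    g-cong : ∀ {s t} → s ≈ t → g s ≈ g t
    g-cong s≈t = +-cong (*-cong s≈t s≈t) (-‿cong s≈t)
    index : Fin (suc r) → Fin (suc r)
    index i = proj₁ (enum-surj (g (enum i)))
    index-spec : ∀ i → g (enum i) ≈ enum (index i)
    index-spec i = proj₂ (enum-surj (g (enum i)))
    oneIndex = proj₁ (enum-surj 1#)
    0≢1 : zeroIndex ≢ oneIndex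
    0≢1 eq = 0≉1 (trans (proj₂ (enum-surj 0#)) (trans (reflexive (≡.cong enum eq)) (sym (proj₂ (enum-surj 1#)))))
    g0≈g1 : enum (index zeroIndex) ≈ enum (index oneIndex)
    g0≈g1 = begin
      enum (index zeroIndex) ≈⟨ index-spec zeroIndex ⟨
      g (enum zeroIndex)     ≈⟨ g-cong (proj₂ (enum-surj 0#)) ⟨
      g 0#                   ≈⟨ trans (+-cong (zeroˡ 0#) -0#≈0#) (+-identityʳ 0#) ⟩
      0#                     ≈⟨ trans (+-congʳ (*-identityˡ 1#)) (-‿inverseʳ 1#) ⟨
      g 1#                   ≈⟨ g-cong (proj₂ (enum-surj 1#)) ⟩
      g (enum oneIndex)      ≈⟨ index-spec oneIndex ⟩
      enum (index oneIndex)  ∎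

  ⋆basis-injective : ∀ {n} {μ μ′} {j j′ : Fin n} → μ ≉ 0# →
    μ ⋆ basis j ≋ μ′ ⋆ basis j′ → j ≡ j′ × μ ≈ μ′
  ⋆basis-injective {μ = μ} {μ′} {j} {j′} μ≉0 eq with j FinP.≟ j′
  ... | yes ≡.refl = ≡.refl , (begin
    μ             ≈⟨ *-identityʳ μ ⟨
    μ * 1#        ≈⟨ *-congˡ (basis-diag j) ⟨
    μ * basis j j  ≈⟨ eq j ⟩
    μ′ * basis j j ≈⟨ *-congˡ (basis-diag j) ⟩
    μ′ * 1#       ≈⟨ *-identityʳ μ′ ⟩
    μ′            ∎)
  ... | no j≢j′ = ⊥-elim (μ≉0 (begin
    μ              ≈⟨ *-identityʳ μ ⟨
    μ * 1#         ≈⟨ *-congˡ (basis-diag j) ⟨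
    μ * basis j j   ≈⟨ eq j ⟩
    μ′ * basis j′ j ≈⟨ *-congˡ (basis-off (λ j′≡j → j≢j′ (≡.sym j′≡j))) ⟩
    μ′ * 0#        ≈⟨ zeroʳ μ′ ⟩
    0#             ∎))

  SpansHyperplane-rescale : ∀ {m n} {a : Vector Carrier n} {w w′ : Fin m → Vector Carrier n}
    (s : Vector Carrier m) (s≉0 : ∀ j → s j ≉ 0#) →
    (∀ j → w′ j ≋ s j ⋆ w j) → SpansHyperplane a w → SpansHyperplane a w′
  SpansHyperplane-rescale {a = a} {w} {w′} s s≉0 w′≋sw (spansHyperplane aw≈0 span) = spansHyperplane aw′≈0 λ x ax≈0 →
    InSpan-rescale (λ j → inv (s j) (s≉0 j)) w≋s⁻¹w′ (span x ax≈0)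
    where
    aw′≈0 : ∀ j → a · w′ j ≈ 0#
    aw′≈0 j = begin
      a · w′ j         ≈⟨ ·-congʳ a (w′≋sw j) ⟩
      a · (s j ⋆ w j)  ≈⟨ ·-⋆ʳ a (s j) (w j) ⟩
      s j * (a · w j)  ≈⟨ *-congˡ (aw≈0 j) ⟩
      s j * 0#         ≈⟨ zeroʳ (s j) ⟩
      0#               ∎
    w≋s⁻¹w′ : ∀ j → w j ≋ inv (s j) (s≉0 j) ⋆ w′ j
    w≋s⁻¹w′ j i = sym (begin
      inv (s j) _ * w′ j i          ≈⟨ *-congˡ (w′≋sw j i) ⟩
      inv (s j) _ * (s j * w j i)   ≈⟨ *-assoc _ _ _ ⟨
      (inv (s j) _ * s j) * w j i   ≈⟨ *-congʳ (*-inverseˡ (s j) (s≉0 j)) ⟩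
      1# * w j i                   ≈⟨ *-identityˡ (w j i) ⟩
      w j i                        ∎)

  IsZero? : ∀ {n} (x : Vector Carrier n) → Dec (IsZero x)
  IsZero? x = FinP.all? (λ i → x i ≟ 0#)

  -- For a₀ ≉ 0 the hyperplane a₀ x₀ + a′ · x′ = 0 is the graph of x′ ↦ -a₀⁻¹ (a′ · x′).
  graphBasis : ∀ {n} (a : Vector Carrier (suc n)) → a zero ≉ 0# → Fin n → Vector Carrier (suc n)
  graphBasis a a₀≉0 j = - (inv (a zero) a₀≉0 * a (suc j)) ∷ basis j

  graphBasis-spans : ∀ {n} (a : Vector Carrier (suc n)) (a₀≉0 : a zero ≉ 0#) →
    SpansHyperplane a (graphBasis a a₀≉0)
  graphBasis-spans a a₀≉0 = spansHyperplane inHyperplane λ x ax≈0 → tail x , spanned x ax≈0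
    where
    a₀ = a zero
    ι = inv a₀ a₀≉0
    inHyperplane : ∀ j → a · graphBasis a a₀≉0 j ≈ 0#
    inHyperplane j = begin
      a₀ * - (ι * a (suc j)) + tail a · basis j ≈⟨ +-congˡ (·-basisʳ (tail a) j) ⟩
      a₀ * - (ι * a (suc j)) + a (suc j)
        ≈⟨ solve 3 (λ a₀ ι b → a₀ :* (:- (ι :* b)) :+ b := :- ((a₀ :* ι) :* b) :+ b) refl a₀ ι (a (suc j)) ⟩
      - ((a₀ * ι) * a (suc j)) + a (suc j)      ≈⟨ +-congʳ (-‿cong (*-congʳ (*-inverseʳ a₀ a₀≉0))) ⟩
      - (1# * a (suc j)) + a (suc j)            ≈⟨ +-congʳ (-‿cong (*-identityˡ _)) ⟩
      - a (suc j) + a (suc j)                   ≈⟨ -‿inverseˡ _ ⟩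
      0#                                        ∎
    spanned : ∀ x → a · x ≈ 0# → ∀ i → x i ≈ sum (λ j → tail x j * graphBasis a a₀≉0 j i)
    spanned x ax≈0 zero = sym (begin
      sum (λ j → x (suc j) * - (ι * a (suc j)))
        ≈⟨ sum-cong-≋ (λ j → solve 3 (λ x ι b → x :* (:- (ι :* b)) := (:- ι) :* (b :* x)) refl (x (suc j)) ι (a (suc j))) ⟩
      sum (λ j → - ι * (a (suc j) * x (suc j))) ≈⟨ *-distribˡ-sum (- ι) (λ j → a (suc j) * x (suc j)) ⟨
      - ι * (tail a · tail x)                  ≈⟨ *-congˡ (inverseˡ-unique _ _ (trans (+-comm _ _) ax≈0)) ⟩
      - ι * - (a₀ * x zero)                    ≈⟨ solve 3 (λ ι a₀ x → (:- ι) :* (:- (a₀ :* x)) := (ι :* a₀) :* x) refl ι a₀ (x zero) ⟩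
      (ι * a₀) * x zero                        ≈⟨ *-congʳ (*-inverseˡ a₀ a₀≉0) ⟩
      1# * x zero                              ≈⟨ *-identityˡ (x zero) ⟩
      x zero                                   ∎)
    spanned x _ (suc i) = sym (sum-basis (tail x) i)

module Construction {c ℓ r} (F : FiniteField c ℓ (suc r)) where
  open FiniteField F hiding (zero)
  open FiniteFieldFacts F
  open BlockingSizeArithmetic using (blockingSize-3; blockingSize-suc)
  open import Relation.Binary.Reasoning.Setoid setoid
  open import Data.Fin using (_↑ˡ_; _↑ʳ_; splitAt; remQuot; combine)
  open import Data.Fin.Properties as FinP using (splitAt-↑ˡ; splitAt-↑ʳ; remQuot-combine)
  open FinLemmas using (splitAt-injective; remQuot-injective)
  open import Data.Sum using (_⊎_; inj₁; inj₂)
  open import Function using (_∘_)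

  -- A v-fold strong blocking set containing the standard basis points; these are what the
  -- extension step needs for hyperplanes with aⱼ₊₁ ≈ 0.
  record FramedBlockingSet (v N : ℕ) : Set (c ⊔ ℓ) where
    field
      point           : Fin N → Vector Carrier (suc v)
      point-nonzero   : ∀ k → ¬ IsZero (point k)
      point-injective : ∀ {k l} → Proportional (point k) (point l) → k ≡ l
      basis-point     : ∀ i → ∃ λ k → point k ≋ basis i
      blocking        : ∀ a → ¬ IsZero a → ∃ λ (sel : Fin v → Fin N) → SpansHyperplane a (point ∘ sel)

  module Extension {v N} (S : FramedBlockingSet v N) where
    open FramedBlockingSet S

    M : ℕ
    M = suc (suc v Nat.* r)

    offset : Fin M → Vector Carrier (suc v)
    offset zero    = λ _ → 0#
    offset (suc k) = nonzeroElem (proj₂ (remQuot {suc v} r k)) ⋆ basis (proj₁ (remQuot {suc v} r k))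

    offset-combine : ∀ j t → offset (suc (combine j t)) ≋ nonzeroElem t ⋆ basis j
    offset-combine j t = ≋-reflexive (≡.cong (λ (j , t) → nonzeroElem t ⋆ basis j) (remQuot-combine j t))

    offset-suc≉0 : ∀ k → ¬ (offset (suc k) ≋ λ _ → 0#)
    offset-suc≉0 k eq = nonzeroElem-≉0 t (proj₂ (⋆basis-injective {j = j} {j} (nonzeroElem-≉0 t) (λ i → trans (eq i) (sym (zeroˡ _)))))
      where
      j = proj₁ (remQuot {suc v} r k)
      t = proj₂ (remQuot {suc v} r k)

    offset-injective : ∀ {k l} → offset k ≋ offset l → k ≡ l
    offset-injective {zero}  {zero}  _  = ≡.refl
    offset-injective {zero}  {suc l} eq = ⊥-elim (offset-suc≉0 l (≋-sym eq))
    offset-injective {suc k} {zero}  eq = ⊥-elim (offset-suc≉0 k eq)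
    offset-injective {suc k} {suc l} eq =
      let j≡j′ , μ≈μ′ = ⋆basis-injective {j = proj₁ (remQuot {suc v} r k)} {proj₁ (remQuot r l)} (nonzeroElem-≉0 _) eq
      in ≡.cong suc (remQuot-injective r (×P.×-≡,≡→≡ (j≡j′ , nonzeroElem-injective μ≈μ′)))

    extended : Fin N ⊎ Fin M → Vector Carrier (suc (suc v))
    extended (inj₁ k) = 0# ∷ point k
    extended (inj₂ k) = 1# ∷ offset k

    extended-nonzero : ∀ s → ¬ IsZero (extended s)
    extended-nonzero (inj₁ k) isZero = point-nonzero k (isZero ∘ suc)
    extended-nonzero (inj₂ k) isZero = 1≉0 (isZero zero)

    -- The first coordinate separates old points (0) from new ones (1) and fixes the scalar.
    extended-injective : ∀ {s t} → Proportional (extended s) (extended t) → s ≡ t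
    extended-injective {inj₁ k} {inj₁ l} (μ , eq) = ≡.cong inj₁ (point-injective (μ , eq ∘ suc))
    extended-injective {inj₁ k} {inj₂ l} (μ , eq) = ⊥-elim (point-nonzero k λ i → begin
      point k i          ≈⟨ eq (suc i) ⟩
      μ * offset l i     ≈⟨ *-congʳ μ≈0 ⟩
      0# * offset l i    ≈⟨ zeroˡ _ ⟩
      0#                 ∎)
      where
      μ≈0 : μ ≈ 0#
      μ≈0 = trans (sym (*-identityʳ μ)) (sym (eq zero))
    extended-injective {inj₂ k} {inj₁ l} (μ , eq) = ⊥-elim (1≉0 (trans (eq zero) (zeroʳ μ)))
    extended-injective {inj₂ k} {inj₂ l} (μ , eq) = ≡.cong inj₂ (offset-injective λ i → begin
      offset k i         ≈⟨ eq (suc i) ⟩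
      μ * offset l i     ≈⟨ *-congʳ μ≈1 ⟩
      1# * offset l i    ≈⟨ *-identityˡ _ ⟩
      offset l i         ∎)
      where
      μ≈1 : μ ≈ 1#
      μ≈1 = trans (sym (*-identityʳ μ)) (sym (eq zero))

    point′ : Fin (N Nat.+ M) → Vector Carrier (suc (suc v))
    point′ = extended ∘ splitAt N

    point′-↑ˡ : ∀ k → point′ (k ↑ˡ M) ≋ 0# ∷ point k
    point′-↑ˡ k = ≋-reflexive (≡.cong extended (splitAt-↑ˡ N k M))

    point′-↑ʳ : ∀ k → point′ (N ↑ʳ k) ≋ 1# ∷ offset k
    point′-↑ʳ k = ≋-reflexive (≡.cong extended (splitAt-↑ʳ N M k))

    point′-injective : ∀ {k l} → Proportional (point′ k) (point′ l) → k ≡ l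
    point′-injective {k} {l} p = splitAt-injective N (extended-injective {splitAt N k} {splitAt N l} p)

    basis-point′ : ∀ i → ∃ λ k → point′ k ≋ basis i
    basis-point′ zero    = N ↑ʳ zero , ≋-trans (point′-↑ʳ zero) λ { zero → refl ; (suc _) → refl }
    basis-point′ (suc i) =
      let k , pk≋ = basis-point i
      in k ↑ˡ M , ≋-trans (point′-↑ˡ k) λ { zero → refl ; (suc j) → pk≋ j }

    -- The j-th graph basis vector is a multiple of the new point 1 ∷ μ ⋆ eⱼ with μ = -a₀/aⱼ₊₁,
    -- or of the old basis point 0 ∷ eⱼ when aⱼ₊₁ ≈ 0.
    graphPoint : ∀ (a : Vector Carrier (suc (suc v))) (a₀≉0 : a zero ≉ 0#) j →
      ∃ λ k → ∃ λ s → s ≉ 0# × point′ k ≋ s ⋆ graphBasis a a₀≉0 j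
    graphPoint a a₀≉0 j with a (suc j) ≟ 0#
    ... | yes aⱼ≈0 =
      let k , pk≋ = basis-point j
      in k ↑ˡ M , 1# , 1≉0 , ≋-trans (point′-↑ˡ k) λ
        { zero    → sym (trans (*-identityˡ _) (trans (-‿cong (trans (*-congˡ aⱼ≈0) (zeroʳ _))) -0#≈0#))
        ; (suc i) → trans (pk≋ i) (sym (*-identityˡ _)) }
    ... | no aⱼ≉0 =
      let t , μ≈t = nonzeroElem-surjective μ μ≉0
      in N ↑ʳ suc (combine j t) , μ , μ≉0 , ≋-trans (point′-↑ʳ _) λ
        { zero    → sym μ-scales-to-1
        ; (suc i) → trans (offset-combine j t i) (*-congʳ (sym μ≈t)) }
      where
      ι = inv (a zero) a₀≉0
      ιⱼ = inv (a (suc j)) aⱼ≉0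
      μ = - (a zero * ιⱼ)
      μ≉0 : μ ≉ 0#
      μ≉0 = -‿≉0 (*-nonzero a₀≉0 (inv-≉0 _ aⱼ≉0))
      μ-scales-to-1 : μ * - (ι * a (suc j)) ≈ 1#
      μ-scales-to-1 = begin
        - (a zero * ιⱼ) * - (ι * a (suc j))
          ≈⟨ solve 4 (λ a₀ ιⱼ ι aⱼ → (:- (a₀ :* ιⱼ)) :* (:- (ι :* aⱼ)) := (a₀ :* ι) :* (ιⱼ :* aⱼ)) refl (a zero) ιⱼ ι (a (suc j)) ⟩
        (a zero * ι) * (ιⱼ * a (suc j))     ≈⟨ *-cong (*-inverseʳ _ a₀≉0) (*-inverseˡ _ aⱼ≉0) ⟩
        1# * 1#                             ≈⟨ *-identityˡ 1# ⟩
        1#                                  ∎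

    blocking′ : ∀ a → ¬ IsZero a → ∃ λ (sel : Fin (suc v) → Fin (N Nat.+ M)) → SpansHyperplane a (point′ ∘ sel)
    blocking′ a a≉0 with a zero ≟ 0#
    ... | yes a₀≈0 = sel′ , SpansHyperplane-cong {a = a} {w′ = point′ ∘ sel′} (SpansHyperplane-axis {a = a} a₀≈0 spans) same
      where
      tail-a≉0 : ¬ IsZero (tail a)
      tail-a≉0 isZero = a≉0 λ { zero → a₀≈0 ; (suc i) → isZero i }
      sel = proj₁ (blocking (tail a) tail-a≉0)
      spans = proj₂ (blocking (tail a) tail-a≉0)
      sel′ : Fin (suc v) → Fin (N Nat.+ M)
      sel′ = (N ↑ʳ zero) ∷ λ j → sel j ↑ˡ M
      same : ∀ j → (basis zero ∷ λ j → 0# ∷ point (sel j)) j ≋ point′ (sel′ j)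
      same zero    = ≋-sym (≋-trans (point′-↑ʳ zero) λ { zero → refl ; (suc _) → refl })
      same (suc j) = ≋-sym (point′-↑ˡ (sel j))
    ... | no a₀≉0 =
      (λ j → proj₁ (graphPoint a a₀≉0 j)) ,
      SpansHyperplane-rescale {a = a} (λ j → proj₁ (proj₂ (graphPoint a a₀≉0 j)))
        (λ j → proj₁ (proj₂ (proj₂ (graphPoint a a₀≉0 j))))
        (λ j → proj₂ (proj₂ (proj₂ (graphPoint a a₀≉0 j))))
        (graphBasis-spans a a₀≉0)

    extension : FramedBlockingSet (suc v) (N Nat.+ M)
    extension = record
      { point           = point′
      ; point-nonzero   = extended-nonzero ∘ splitAt N
      ; point-injective = point′-injective
      ; basis-point     = basis-point′
      ; blocking        = blocking′
      }

  module BaseCase (κ : Carrier) (κ-spec : ∀ t → t * t + - t ≉ κ) where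
    open import Data.Fin.Patterns using (0F; 1F; 2F; 3F)
    open import Data.Vec.Functional using (_++_; take; drop)

    Q : ℕ
    Q = suc (suc r)

    pair : Carrier → Carrier → Vector Carrier 2
    pair x y = x ∷ y ∷ []

    0₂ : Vector Carrier 2
    0₂ = λ _ → 0#

    -- Homogeneous coordinates of the q + 1 points of PG(1,q).
    linePoint : Fin Q → Vector Carrier 2
    linePoint zero    = pair 1# 0#
    linePoint (suc i) = pair (enum i) 1#

    linePoint-nonzero : ∀ t → ¬ IsZero (linePoint t)
    linePoint-nonzero zero    isZero = 1≉0 (isZero 0F)
    linePoint-nonzero (suc i) isZero = 1≉0 (isZero 1F)

    linePoint-e₁ : linePoint (suc zeroIndex) ≋ pair 0# 1#
    linePoint-e₁ = λ { 0F → sym (proj₂ (enum-surj 0#)) ; 1F → refl }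

    linePoint-injective : ∀ {t t′} → Proportional (linePoint t) (linePoint t′) → t ≡ t′
    linePoint-injective {zero}  {zero}  _       = ≡.refl
    linePoint-injective {zero}  {suc j} (μ , h) =
      ⊥-elim (1≉0 (trans (h 0F) (trans (*-congʳ (trans (sym (*-identityʳ μ)) (sym (h 1F)))) (zeroˡ _))))
    linePoint-injective {suc i} {zero}  (μ , h) = ⊥-elim (1≉0 (trans (h 1F) (zeroʳ μ)))
    linePoint-injective {suc i} {suc j} (μ , h) =
      ≡.cong suc (enum-inj i j (trans (h 0F) (trans (*-congʳ μ≈1) (*-identityˡ _))))
      where
      μ≈1 : μ ≈ 1#
      μ≈1 = trans (sym (*-identityʳ μ)) (sym (h 1F))

    linePoint-∈-kernel : ∀ b → ∃ λ t → b · linePoint t ≈ 0#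
    linePoint-∈-kernel b with b 0F ≟ 0#
    ... | yes b₀≈0 = zero , trans (+-cong (trans (*-identityʳ _) b₀≈0) (+-identityʳ _)) (trans (+-congˡ (zeroʳ _)) (+-identityʳ 0#))
    ... | no b₀≉0  =
      let i , s≈i = enum-surj s
      in suc i , (begin
        b 0F * enum i + (b 1F * 1# + 0#) ≈⟨ +-cong (*-congˡ (sym s≈i)) (trans (+-identityʳ _) (*-identityʳ _)) ⟩
        b 0F * s + b 1F
          ≈⟨ +-congʳ (solve 3 (λ b₀ b₁ ι → b₀ :* (:- (b₁ :* ι)) := :- (b₁ :* (b₀ :* ι))) refl (b 0F) (b 1F) ι) ⟩
        - (b 1F * (b 0F * ι)) + b 1F      ≈⟨ +-congʳ (-‿cong (trans (*-congˡ (*-inverseʳ _ b₀≉0)) (*-identityʳ _))) ⟩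
        - b 1F + b 1F                    ≈⟨ -‿inverseˡ _ ⟩
        0#                               ∎)
      where
      ι = inv (b 0F) b₀≉0
      s = - (b 1F * ι)

    kernel-∝-linePoint : ∀ {b y} t → ¬ IsZero b → b · linePoint t ≈ 0# → b · y ≈ 0# → ∃ λ α → y ≋ α ⋆ linePoint t
    kernel-∝-linePoint {b} {y} zero b≉0 bP≈0 by≈0 = y 0F , λ { 0F → sym (*-identityʳ _) ; 1F → trans y₁≈0 (sym (zeroʳ _)) }
      where
      b₀≈0 : b 0F ≈ 0#
      b₀≈0 = trans (sym (*-identityʳ _)) (trans (sym (+-identityʳ _))
        (trans (+-congˡ (sym (trans (+-congʳ (zeroʳ _)) (+-identityʳ 0#)))) bP≈0))
      b₁≉0 : b 1F ≉ 0#
      b₁≉0 b₁≈0 = b≉0 λ { 0F → b₀≈0 ; 1F → b₁≈0 }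
      y₁≈0 : y 1F ≈ 0#
      y₁≈0 = x*y≈0⇒y≈0 (trans (sym (+-identityʳ _)) (trans (sym (+-identityˡ _))
        (trans (+-congʳ (sym (trans (*-congʳ b₀≈0) (zeroˡ _)))) by≈0))) b₁≉0
    kernel-∝-linePoint {b} {y} (suc i) b≉0 bP≈0 by≈0 = y 1F , λ { 0F → y₀≈y₁e ; 1F → sym (*-identityʳ _) }
      where
      b₁≈-b₀e : b 1F ≈ - (b 0F * enum i)
      b₁≈-b₀e = inverseˡ-unique _ _ (trans (+-comm _ _) (trans (+-congˡ (sym (trans (+-identityʳ _) (*-identityʳ _)))) bP≈0))
      b₀≉0 : b 0F ≉ 0#
      b₀≉0 b₀≈0 = b≉0 λ { 0F → b₀≈0 ; 1F → trans b₁≈-b₀e (trans (-‿cong (trans (*-congʳ b₀≈0) (zeroˡ _))) -0#≈0#) }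
      y₀≈y₁e : y 0F ≈ y 1F * enum i
      y₀≈y₁e = *-cancelˡ b₀≉0 (begin
        b 0F * y 0F                  ≈⟨ inverseˡ-unique _ _ (trans (+-congˡ (sym (+-identityʳ _))) by≈0) ⟩
        - (b 1F * y 1F)              ≈⟨ -‿cong (*-congʳ b₁≈-b₀e) ⟩
        - (- (b 0F * enum i) * y 1F) ≈⟨ solve 3 (λ b₀ e y₁ → :- ((:- (b₀ :* e)) :* y₁) := b₀ :* (y₁ :* e)) refl (b 0F) (enum i) (y 1F) ⟩
        b 0F * (y 1F * enum i)       ∎)

    det : Vector Carrier 2 → Vector Carrier 2 → Carrier
    det p p′ = p 0F * p′ 1F + - (p 1F * p′ 0F)

    -- The matrix (0 κ; 1 -1) has characteristic polynomial λ² + λ - κ, irreducible by the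
    -- choice of κ, so it moves every point of PG(1,q).
    twist : Vector Carrier 2 → Vector Carrier 2
    twist p = pair (κ * p 1F) (p 0F + - p 1F)

    det-twist≉0 : ∀ t → det (linePoint t) (twist (linePoint t)) ≉ 0#
    det-twist≉0 zero det≈0 = 1≉0 (trans (sym (begin
      1# * (1# + - 0#) + - (0# * (κ * 0#)) ≈⟨ +-cong (*-identityˡ _) (-‿cong (zeroˡ _)) ⟩
      (1# + - 0#) + - 0#                  ≈⟨ +-cong (+-congˡ -0#≈0#) -0#≈0# ⟩
      (1# + 0#) + 0#                      ≈⟨ trans (+-identityʳ _) (+-identityʳ _) ⟩
      1#                                  ∎)) det≈0)
    det-twist≉0 (suc i) det≈0 = κ-spec (enum i) (trans (inverseˡ-unique _ _ (begin
      (e * e + - e) + - κ                 ≈⟨ +-congʳ (+-congˡ (-‿cong (*-identityʳ e))) ⟨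
      (e * e + - (e * 1#)) + - κ          ≈⟨ +-congʳ (+-congˡ (-‿distribʳ-* e 1#)) ⟩
      (e * e + e * - 1#) + - κ            ≈⟨ +-cong (distribˡ e e (- 1#)) (-‿cong (trans (*-identityˡ _) (*-identityʳ κ))) ⟨
      e * (e + - 1#) + - (1# * (κ * 1#))  ≈⟨ det≈0 ⟩
      0#                                  ∎)) (-‿involutive κ))
      where e = enum i

    line↑ line↓ : Fin 4 → Vector Carrier 2 → Vector Carrier 2
    line↑ 0F p = p
    line↑ 1F p = 0₂
    line↑ 2F p = p
    line↑ 3F p = p
    line↓ 0F p = 0₂
    line↓ 1F p = p
    line↓ 2F p = p
    line↓ 3F p = twist p

    line : Fin 4 → Vector Carrier 2 → Vector Carrier 4
    line L p = line↑ L p ++ line↓ L p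

    upper : ∀ {x y x′ y′ : Vector Carrier 2} {μ} → x ++ y ≋ μ ⋆ (x′ ++ y′) → x ≋ μ ⋆ x′
    upper h = λ { 0F → h 0F ; 1F → h 1F }

    lower : ∀ {x y x′ y′ : Vector Carrier 2} {μ} → x ++ y ≋ μ ⋆ (x′ ++ y′) → y ≋ μ ⋆ y′
    lower h = λ { 0F → h 2F ; 1F → h 3F }

    scale≈0 : ∀ {μ} {p : Vector Carrier 2} → ¬ IsZero p → 0₂ ≋ μ ⋆ p → μ ≈ 0#
    scale≈0 {μ} p≉0 0≋μp with μ ≟ 0#
    ... | yes μ≈0 = μ≈0
    ... | no μ≉0  = ⊥-elim (p≉0 λ i → x*y≈0⇒y≈0 (sym (0≋μp i)) μ≉0)

    linePoint-≉-zeroScale : ∀ t {μ} {p : Vector Carrier 2} → μ ≈ 0# → ¬ (linePoint t ≋ μ ⋆ p)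
    linePoint-≉-zeroScale t μ≈0 P≋μp = linePoint-nonzero t λ i → trans (P≋μp i) (trans (*-congʳ μ≈0) (zeroˡ _))

    twist-nonzero : ∀ t → ¬ IsZero (twist (linePoint t))
    twist-nonzero t isZero = det-twist≉0 t (begin
      P 0F * twist P 1F + - (P 1F * twist P 0F) ≈⟨ +-cong (*-congˡ (isZero 1F)) (-‿cong (*-congˡ (isZero 0F))) ⟩
      P 0F * 0# + - (P 1F * 0#)                 ≈⟨ +-cong (zeroʳ _) (trans (-‿cong (zeroʳ _)) -0#≈0#) ⟩
      0# + 0#                                   ≈⟨ +-identityʳ 0# ⟩
      0#                                        ∎)
      where P = linePoint t

    onLine : Fin 4 × Fin Q → Vector Carrier 4
    onLine (L , t) = line L (linePoint t)

    onLine-nonzero : ∀ s → ¬ IsZero (onLine s)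
    onLine-nonzero (0F , t) isZero = linePoint-nonzero t λ { 0F → isZero 0F ; 1F → isZero 1F }
    onLine-nonzero (1F , t) isZero = linePoint-nonzero t λ { 0F → isZero 2F ; 1F → isZero 3F }
    onLine-nonzero (2F , t) isZero = linePoint-nonzero t λ { 0F → isZero 0F ; 1F → isZero 1F }
    onLine-nonzero (3F , t) isZero = linePoint-nonzero t λ { 0F → isZero 0F ; 1F → isZero 1F }

    twist-has-no-fixed-point : ∀ t → ¬ (linePoint t ≋ twist (linePoint t))
    twist-has-no-fixed-point t P≋twist = det-twist≉0 t (begin
      P 0F * twist P 1F + - (P 1F * twist P 0F) ≈⟨ +-congˡ (-‿cong (*-cong (sym (P≋twist 1F)) (P≋twist 0F))) ⟨
      P 0F * twist P 1F + - (twist P 1F * P 0F) ≈⟨ +-congˡ (-‿cong (*-comm _ _)) ⟩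
      P 0F * twist P 1F + - (P 0F * twist P 1F) ≈⟨ -‿inverseʳ _ ⟩
      0#                                        ∎)
      where P = linePoint t

    lines-skew : ∀ L L′ t t′ → L ≢ L′ → ¬ Proportional (line L (linePoint t)) (line L′ (linePoint t′))
    lines-skew 0F 0F _ _  L≢L′ = ⊥-elim (L≢L′ ≡.refl)
    lines-skew 1F 1F _ _  L≢L′ = ⊥-elim (L≢L′ ≡.refl)
    lines-skew 2F 2F _ _  L≢L′ = ⊥-elim (L≢L′ ≡.refl)
    lines-skew 3F 3F _ _  L≢L′ = ⊥-elim (L≢L′ ≡.refl)
    lines-skew 0F 1F t _  _ (μ , h) = linePoint-nonzero t λ i → trans (upper h i) (zeroʳ μ)
    lines-skew 1F 0F t _  _ (μ , h) = linePoint-nonzero t λ i → trans (lower h i) (zeroʳ μ)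
    lines-skew 0F 2F t t′ _ (μ , h) = linePoint-≉-zeroScale t (scale≈0 (linePoint-nonzero t′) (lower h)) (upper h)
    lines-skew 2F 0F t _  _ (μ , h) = linePoint-nonzero t λ i → trans (lower h i) (zeroʳ μ)
    lines-skew 0F 3F t t′ _ (μ , h) = linePoint-≉-zeroScale t (scale≈0 (twist-nonzero t′) (lower h)) (upper h)
    lines-skew 3F 0F t _  _ (μ , h) = twist-nonzero t λ i → trans (lower h i) (zeroʳ μ)
    lines-skew 1F 2F t t′ _ (μ , h) = linePoint-≉-zeroScale t (scale≈0 (linePoint-nonzero t′) (upper h)) (lower h)
    lines-skew 2F 1F t _  _ (μ , h) = linePoint-nonzero t λ i → trans (upper h i) (zeroʳ μ)
    lines-skew 1F 3F t t′ _ (μ , h) = linePoint-≉-zeroScale t (scale≈0 (linePoint-nonzero t′) (upper h)) (lower h)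
    lines-skew 3F 1F t _  _ (μ , h) = linePoint-nonzero t λ i → trans (upper h i) (zeroʳ μ)
    lines-skew 2F 3F t t′ _ (μ , h) = twist-has-no-fixed-point t′ λ i →
      *-cancelˡ (λ μ≈0 → linePoint-≉-zeroScale t μ≈0 (upper h)) (trans (sym (upper h i)) (lower h i))
    lines-skew 3F 2F t t′ _ (μ , h) = twist-has-no-fixed-point t λ i → trans (upper h i) (sym (lower h i))

    onLine-injective : ∀ {s s′} → Proportional (onLine s) (onLine s′) → s ≡ s′
    onLine-injective {L , t} {L′ , t′} p with L FinP.≟ L′
    ... | no L≢L′    = ⊥-elim (lines-skew L L′ t t′ L≢L′ p)
    ... | yes ≡.refl = ≡.cong (L ,_) (linePoint-injective (sameLine L p))
      where
      sameLine : ∀ L → Proportional (line L (linePoint t)) (line L (linePoint t′)) → Proportional (linePoint t) (linePoint t′)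
      sameLine 0F (μ , h) = μ , upper h
      sameLine 1F (μ , h) = μ , lower h
      sameLine 2F (μ , h) = μ , upper h
      sameLine 3F (μ , h) = μ , upper h

    u*x-w*y≈0 : ∀ {x y u w} → x ≈ 0# → y ≈ 0# → u * x + - (w * y) ≈ 0#
    u*x-w*y≈0 x≈0 y≈0 =
      trans (+-cong (trans (*-congˡ x≈0) (zeroʳ _)) (trans (-‿cong (trans (*-congˡ y≈0) (zeroʳ _))) -0#≈0#)) (+-identityʳ 0#)

    first-term≈0 : ∀ {z u x w y} → z ≈ u * x + - (w * y) → z ≈ 0# → y ≈ 0# → u * x ≈ 0#
    first-term≈0 {z} {u} {x} {w} {y} z≈ z≈0 y≈0 = begin
      u * x              ≈⟨ +-identityʳ _ ⟨
      u * x + 0#         ≈⟨ +-congˡ (trans (-‿cong (trans (*-congˡ y≈0) (zeroʳ w))) -0#≈0#) ⟨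
      u * x + - (w * y)  ≈⟨ trans (sym z≈) z≈0 ⟩
      0#                 ∎

    second-term≈0 : ∀ {z u x w y} → z ≈ u * x + - (w * y) → z ≈ 0# → x ≈ 0# → w * y ≈ 0#
    second-term≈0 {z} {u} {x} {w} {y} z≈ z≈0 x≈0 = begin
      w * y              ≈⟨ -‿involutive _ ⟨
      - - (w * y)        ≈⟨ -‿cong -wy≈0 ⟩
      - 0#               ≈⟨ -0#≈0# ⟩
      0#                 ∎
      where
      -wy≈0 : - (w * y) ≈ 0#
      -wy≈0 = trans (sym (trans (+-congʳ (trans (*-congˡ x≈0) (zeroʳ u))) (+-identityˡ _))) (trans (sym z≈) z≈0)

    ·₂ : ∀ (b p : Vector Carrier 2) → b · p ≈ b 0F * p 0F + b 1F * p 1F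
    ·₂ b p = +-congˡ (+-identityʳ _)

    -- Cramer's rule in dimension 2: det (p, p′) b = (b · p) J p′ - (b · p′) J p, where J (x, y) = (y, -x).
    cramer₀ : ∀ b p p′ → b 0F * det p p′ ≈ p′ 1F * (b · p) + - (p 1F * (b · p′))
    cramer₀ b p p′ = trans (identity (b 0F) (b 1F) (p 0F) (p 1F) (p′ 0F) (p′ 1F))
      (sym (+-cong (*-congˡ (·₂ b p)) (-‿cong (*-congˡ (·₂ b p′)))))
      where
      identity : ∀ b₀ b₁ p₀ p₁ p₀′ p₁′ →
        b₀ * (p₀ * p₁′ + - (p₁ * p₀′)) ≈ p₁′ * (b₀ * p₀ + b₁ * p₁) + - (p₁ * (b₀ * p₀′ + b₁ * p₁′))
      identity = solve 6 (λ b₀ b₁ p₀ p₁ p₀′ p₁′ →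
        b₀ :* (p₀ :* p₁′ :+ :- (p₁ :* p₀′)) := p₁′ :* (b₀ :* p₀ :+ b₁ :* p₁) :+ :- (p₁ :* (b₀ :* p₀′ :+ b₁ :* p₁′))) refl

    cramer₁ : ∀ b p p′ → b 1F * det p p′ ≈ p 0F * (b · p′) + - (p′ 0F * (b · p))
    cramer₁ b p p′ = trans (identity (b 0F) (b 1F) (p 0F) (p 1F) (p′ 0F) (p′ 1F))
      (sym (+-cong (*-congˡ (·₂ b p′)) (-‿cong (*-congˡ (·₂ b p)))))
      where
      identity : ∀ b₀ b₁ p₀ p₁ p₀′ p₁′ →
        b₁ * (p₀ * p₁′ + - (p₁ * p₀′)) ≈ p₀ * (b₀ * p₀′ + b₁ * p₁′) + - (p₀′ * (b₀ * p₀ + b₁ * p₁))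
      identity = solve 6 (λ b₀ b₁ p₀ p₁ p₀′ p₁′ →
        b₁ :* (p₀ :* p₁′ :+ :- (p₁ :* p₀′)) := p₀ :* (b₀ :* p₀′ :+ b₁ :* p₁′) :+ :- (p₀′ :* (b₀ :* p₀ :+ b₁ :* p₁))) refl

    det-kernel : ∀ {b p p′} → ¬ IsZero b → b · p ≈ 0# → b · p′ ≈ 0# → det p p′ ≈ 0#
    det-kernel {b} {p} {p′} b≉0 bp≈0 bp′≈0 with b 0F ≟ 0#
    ... | no b₀≉0  = x*y≈0⇒y≈0 (trans (cramer₀ b p p′) (u*x-w*y≈0 bp≈0 bp′≈0)) b₀≉0
    ... | yes b₀≈0 = x*y≈0⇒y≈0 (trans (cramer₁ b p p′) (u*x-w*y≈0 bp′≈0 bp≈0)) λ b₁≈0 → b≉0 λ { 0F → b₀≈0 ; 1F → b₁≈0 }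

    det≉0⇒trivial-kernel : ∀ {A B p} → det A B ≉ 0# → A · p ≈ 0# → B · p ≈ 0# → IsZero p
    det≉0⇒trivial-kernel {A} {B} {p} det≉0 Ap≈0 Bp≈0 = λ
      { 0F → x*y≈0⇒y≈0 (trans (*-comm _ _) (trans (cramer₀ p A B) (u*x-w*y≈0 pA≈0 pB≈0))) det≉0
      ; 1F → x*y≈0⇒y≈0 (trans (*-comm _ _) (trans (cramer₁ p A B) (u*x-w*y≈0 pB≈0 pA≈0))) det≉0 }
      where
      pA≈0 = trans (·-comm p A) Ap≈0
      pB≈0 = trans (·-comm p B) Bp≈0

    det≈0⇒same-kernel : ∀ {A B p} → det A B ≈ 0# → ¬ IsZero A → A · p ≈ 0# → B · p ≈ 0#
    det≈0⇒same-kernel {A} {B} {p} det≈0 A≉0 Ap≈0 with A 0F ≟ 0#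
    ... | no A₀≉0 =
      trans (·-comm B p) (x*y≈0⇒y≈0 (first-term≈0 (cramer₁ p A B) (trans (*-congˡ det≈0) (zeroʳ _)) (trans (·-comm p A) Ap≈0)) A₀≉0)
    ... | yes A₀≈0 =
      trans (·-comm B p) (x*y≈0⇒y≈0 (second-term≈0 (cramer₀ p A B) (trans (*-congˡ det≈0) (zeroʳ _)) (trans (·-comm p A) Ap≈0))
        λ A₁≈0 → A≉0 λ { 0F → A₀≈0 ; 1F → A₁≈0 })

    ·-++ : ∀ (a : Vector Carrier 4) x y → a · (x ++ y) ≈ take 2 a · x + drop 2 a · y
    ·-++ a x y = begin
      a 0F * x 0F + (a 1F * x 1F + (a 2F * y 0F + (a 3F * y 1F + 0#))) ≈⟨ +-congˡ (+-congˡ (+-congˡ (+-identityʳ _))) ⟩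
      a 0F * x 0F + (a 1F * x 1F + (a 2F * y 0F + a 3F * y 1F))        ≈⟨ +-assoc _ _ _ ⟨
      (a 0F * x 0F + a 1F * x 1F) + (a 2F * y 0F + a 3F * y 1F)        ≈⟨ +-cong (·₂ (take 2 a) x) (·₂ (drop 2 a) y) ⟨
      take 2 a · x + drop 2 a · y                                       ∎

    InSpan₃-++ : ∀ {u↑ u↓ v↑ v↓ w↑ w↓ : Vector Carrier 2} {x : Vector Carrier 4} α β γ →
      (∀ i → take 2 x i ≈ α * u↑ i + (β * v↑ i + γ * w↑ i)) →
      (∀ i → drop 2 x i ≈ α * u↓ i + (β * v↓ i + γ * w↓ i)) →
      InSpan ((u↑ ++ u↓) ∷ (v↑ ++ v↓) ∷ (w↑ ++ w↓) ∷ []) x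
    InSpan₃-++ α β γ up down = InSpan₃ α β γ λ { 0F → up 0F ; 1F → up 1F ; 2F → down 0F ; 3F → down 1F }

    x≈[x-y]+y : ∀ x y → x ≈ (x + - y) + y
    x≈[x-y]+y = solve 2 (λ x y → x := (x :+ :- y) :+ y) refl

    0*-summand : ∀ β c → c ≈ β * 0# + c
    0*-summand β c = sym (trans (+-congʳ (zeroʳ β)) (+-identityˡ c))

    -- A point x = y ++ z of the hyperplane is γ w plus a point of each of the first two lines,
    -- where γ = (B · z) / (B · w↓).
    SpansHyperplane-transversal : ∀ {a : Vector Carrier 4} {t t′} {w↑ w↓ : Vector Carrier 2} →
      ¬ IsZero (take 2 a) → ¬ IsZero (drop 2 a) →
      take 2 a · linePoint t ≈ 0# → drop 2 a · linePoint t′ ≈ 0# →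
      take 2 a · w↑ + drop 2 a · w↓ ≈ 0# → drop 2 a · w↓ ≉ 0# →
      SpansHyperplane a (line 0F (linePoint t) ∷ line 1F (linePoint t′) ∷ (w↑ ++ w↓) ∷ [])
    SpansHyperplane-transversal {a} {t} {t′} {w↑} {w↓} A≉0 B≉0 AP≈0 BP′≈0 Aw+Bw≈0 Bw≉0 = spansHyperplane inHyperplane spanned
      where
      A = take 2 a
      B = drop 2 a
      inHyperplane : ∀ j → a · (line 0F (linePoint t) ∷ line 1F (linePoint t′) ∷ (w↑ ++ w↓) ∷ []) j ≈ 0#
      inHyperplane 0F = trans (·-++ a (linePoint t) 0₂) (trans (+-cong AP≈0 (·-zeroʳ B)) (+-identityʳ 0#))
      inHyperplane 1F = trans (·-++ a 0₂ (linePoint t′)) (trans (+-cong (·-zeroʳ A) BP′≈0) (+-identityʳ 0#))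
      inHyperplane 2F = trans (·-++ a w↑ w↓) Aw+Bw≈0

      spanned : ∀ x → a · x ≈ 0# → InSpan (line 0F (linePoint t) ∷ line 1F (linePoint t′) ∷ (w↑ ++ w↓) ∷ []) x
      spanned x ax≈0 = InSpan₃-++ α β γ
        (λ i → trans (x≈[x-y]+y (y i) (γ * w↑ i)) (+-cong (y′≋ i) (0*-summand β (γ * w↑ i))))
        (λ i → trans (x≈[x-y]+y (z i) (γ * w↓ i)) (trans (+-cong (z′≋ i) refl) (0*-summand α _)))
        where
        y = take 2 x
        z = drop 2 x
        Ay≈-Bz : A · y ≈ - (B · z)
        Ay≈-Bz = inverseˡ-unique _ _ (trans (sym (·-++ a y z)) ax≈0)
        γ = (B · z) * inv (B · w↓) Bw≉0
        γBw≈Bz : γ * (B · w↓) ≈ B · z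
        γBw≈Bz = trans (*-assoc _ _ _) (trans (*-congˡ (*-inverseˡ _ Bw≉0)) (*-identityʳ _))
        Bz′≈0 : B · (λ i → z i + - (γ * w↓ i)) ≈ 0#
        Bz′≈0 = trans (·-linearʳ B z w↓ γ) (trans (+-congˡ (-‿cong γBw≈Bz)) (-‿inverseʳ _))
        Ay′≈0 : A · (λ i → y i + - (γ * w↑ i)) ≈ 0#
        Ay′≈0 = begin
          A · (λ i → y i + - (γ * w↑ i)) ≈⟨ ·-linearʳ A y w↑ γ ⟩
          A · y + - (γ * (A · w↑))       ≈⟨ +-cong Ay≈-Bz (-‿cong (*-congˡ (inverseˡ-unique _ _ Aw+Bw≈0))) ⟩
          - (B · z) + - (γ * - (B · w↓)) ≈⟨ +-congˡ (solve 2 (λ γ b → :- (γ :* :- b) := γ :* b) refl γ (B · w↓)) ⟩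
          - (B · z) + γ * (B · w↓)       ≈⟨ +-congˡ γBw≈Bz ⟩
          - (B · z) + B · z              ≈⟨ -‿inverseˡ _ ⟩
          0#                             ∎
        α = proj₁ (kernel-∝-linePoint t A≉0 AP≈0 Ay′≈0)
        y′≋ = proj₂ (kernel-∝-linePoint t A≉0 AP≈0 Ay′≈0)
        β = proj₁ (kernel-∝-linePoint t′ B≉0 BP′≈0 Bz′≈0)
        z′≋ = proj₂ (kernel-∝-linePoint t′ B≉0 BP′≈0 Bz′≈0)

    only-first : ∀ x y z → x ≈ x * 1# + (y * 0# + z * 0#)
    only-first x y z = sym (trans (+-cong (*-identityʳ x) (trans (+-cong (zeroʳ y) (zeroʳ z)) (+-identityʳ 0#))) (+-identityʳ x))

    only-second : ∀ x y z → y ≈ x * 0# + (y * 1# + z * 0#)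
    only-second x y z = sym (trans (+-cong (zeroʳ x) (trans (+-cong (*-identityʳ y) (zeroʳ z)) (+-identityʳ y))) (+-identityˡ y))

    only-third : ∀ x y w → w ≈ x * 0# + (y * 0# + w)
    only-third x y w = trans (0*-summand y w) (0*-summand x _)

    SpansHyperplane-upper-zero : ∀ {a : Vector Carrier 4} {t} → IsZero (take 2 a) → ¬ IsZero (drop 2 a) →
      drop 2 a · linePoint t ≈ 0# →
      SpansHyperplane a (line 0F (pair 1# 0#) ∷ line 0F (pair 0# 1#) ∷ line 1F (linePoint t) ∷ [])
    SpansHyperplane-upper-zero {a} {t} A≈0 B≉0 BP≈0 = spansHyperplane inHyperplane spanned
      where
      A = take 2 a
      B = drop 2 a
      inHyperplane : ∀ j → a · (line 0F (pair 1# 0#) ∷ line 0F (pair 0# 1#) ∷ line 1F (linePoint t) ∷ []) j ≈ 0#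
      inHyperplane 0F = trans (·-++ a (pair 1# 0#) 0₂) (trans (+-cong (·-zeroˡ (pair 1# 0#) A≈0) (·-zeroʳ B)) (+-identityʳ 0#))
      inHyperplane 1F = trans (·-++ a (pair 0# 1#) 0₂) (trans (+-cong (·-zeroˡ (pair 0# 1#) A≈0) (·-zeroʳ B)) (+-identityʳ 0#))
      inHyperplane 2F = trans (·-++ a 0₂ (linePoint t)) (trans (+-cong (·-zeroˡ 0₂ A≈0) BP≈0) (+-identityʳ 0#))

      spanned : ∀ x → a · x ≈ 0# → InSpan (line 0F (pair 1# 0#) ∷ line 0F (pair 0# 1#) ∷ line 1F (linePoint t) ∷ []) x
      spanned x ax≈0 = InSpan₃-++ (x 0F) (x 1F) β
        (λ { 0F → only-first (x 0F) (x 1F) β ; 1F → only-second (x 0F) (x 1F) β })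
        (λ i → trans (z≋ i) (only-third (x 0F) (x 1F) _))
        where
        Bz≈0 : B · drop 2 x ≈ 0#
        Bz≈0 = trans (sym (+-identityˡ _)) (trans (+-congʳ (sym (·-zeroˡ (take 2 x) A≈0))) (trans (sym (·-++ a (take 2 x) (drop 2 x))) ax≈0))
        β = proj₁ (kernel-∝-linePoint t B≉0 BP≈0 Bz≈0)
        z≋ = proj₂ (kernel-∝-linePoint t B≉0 BP≈0 Bz≈0)

    SpansHyperplane-lower-zero : ∀ {a : Vector Carrier 4} {t} → ¬ IsZero (take 2 a) → IsZero (drop 2 a) →
      take 2 a · linePoint t ≈ 0# →
      SpansHyperplane a (line 1F (pair 1# 0#) ∷ line 1F (pair 0# 1#) ∷ line 0F (linePoint t) ∷ [])
    SpansHyperplane-lower-zero {a} {t} A≉0 B≈0 AP≈0 = spansHyperplane inHyperplane spanned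
      where
      A = take 2 a
      B = drop 2 a
      inHyperplane : ∀ j → a · (line 1F (pair 1# 0#) ∷ line 1F (pair 0# 1#) ∷ line 0F (linePoint t) ∷ []) j ≈ 0#
      inHyperplane 0F = trans (·-++ a 0₂ (pair 1# 0#)) (trans (+-cong (·-zeroʳ A) (·-zeroˡ (pair 1# 0#) B≈0)) (+-identityʳ 0#))
      inHyperplane 1F = trans (·-++ a 0₂ (pair 0# 1#)) (trans (+-cong (·-zeroʳ A) (·-zeroˡ (pair 0# 1#) B≈0)) (+-identityʳ 0#))
      inHyperplane 2F = trans (·-++ a (linePoint t) 0₂) (trans (+-cong AP≈0 (·-zeroˡ 0₂ B≈0)) (+-identityʳ 0#))

      spanned : ∀ x → a · x ≈ 0# → InSpan (line 1F (pair 1# 0#) ∷ line 1F (pair 0# 1#) ∷ line 0F (linePoint t) ∷ []) x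
      spanned x ax≈0 = InSpan₃-++ (x 2F) (x 3F) α
        (λ i → trans (y≋ i) (only-third (x 2F) (x 3F) _))
        (λ { 0F → only-first (x 2F) (x 3F) α ; 1F → only-second (x 2F) (x 3F) α })
        where
        Ay≈0 : A · take 2 x ≈ 0#
        Ay≈0 = trans (sym (+-identityʳ _)) (trans (+-congˡ (sym (·-zeroˡ (drop 2 x) B≈0))) (trans (sym (·-++ a (take 2 x) (drop 2 x))) ax≈0))
        α = proj₁ (kernel-∝-linePoint t A≉0 AP≈0 Ay≈0)
        y≋ = proj₂ (kernel-∝-linePoint t A≉0 AP≈0 Ay≈0)

    twistᵀ : Vector Carrier 2 → Vector Carrier 2
    twistᵀ b = pair (b 1F) (κ * b 0F + - b 1F)

    ·-twist : ∀ b p → b · twist p ≈ twistᵀ b · p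
    ·-twist b p = begin
      b · twist p                                       ≈⟨ ·₂ b (twist p) ⟩
      b 0F * (κ * p 1F) + b 1F * (p 0F + - p 1F)
        ≈⟨ solve 5 (λ b₀ b₁ κ p₀ p₁ → b₀ :* (κ :* p₁) :+ b₁ :* (p₀ :+ :- p₁) := b₁ :* p₀ :+ (κ :* b₀ :+ :- b₁) :* p₁)
             refl (b 0F) (b 1F) κ (p 0F) (p 1F) ⟩
      b 1F * p 0F + (κ * b 0F + - b 1F) * p 1F          ≈⟨ ·₂ (twistᵀ b) p ⟨
      twistᵀ b · p                                      ∎

    ThirdPoint : Vector Carrier 2 → Vector Carrier 2 → Set ℓ
    ThirdPoint A B = ∃ λ L → ∃ λ t →
      A · line↑ L (linePoint t) + B · line↓ L (linePoint t) ≈ 0# × B · line↓ L (linePoint t) ≉ 0#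

    thirdPoint : ∀ {A B} → ¬ IsZero A → ¬ IsZero B → ThirdPoint A B
    thirdPoint {A} {B} A≉0 B≉0 with det A B ≟ 0#
    ... | no det≉0 =
      let s , [A+B]P≈0 = linePoint-∈-kernel (λ i → A i + B i)
          AP+BP≈0 = trans (sym (·-distribʳ-+ A B (linePoint s))) [A+B]P≈0
      in 2F , s , AP+BP≈0 , λ BP≈0 → linePoint-nonzero s
           (det≉0⇒trivial-kernel {A} {B} {linePoint s} det≉0 (trans (sym (+-identityʳ _)) (trans (+-congˡ (sym BP≈0)) AP+BP≈0)) BP≈0)
    ... | yes det≈0 =
      let s , [A+B′]P≈0 = linePoint-∈-kernel (λ i → A i + twistᵀ B i)
          P = linePoint s
          AP+BtP≈0 : A · P + B · twist P ≈ 0#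
          AP+BtP≈0 = trans (+-congˡ (·-twist B P)) (trans (sym (·-distribʳ-+ A (twistᵀ B) P)) [A+B′]P≈0)
      in 3F , s , AP+BtP≈0 , λ BtP≈0 →
           let AP≈0 = trans (sym (+-identityʳ _)) (trans (+-congˡ (sym BtP≈0)) AP+BtP≈0)
           in det-twist≉0 s (det-kernel {B} {P} {twist P} B≉0 (det≈0⇒same-kernel {A} {B} {P} det≈0 A≉0 AP≈0) BtP≈0)

    Spanning : Vector Carrier 4 → (Fin 3 → Fin 4 × Fin Q) → Set (c ⊔ ℓ)
    Spanning a sel = SpansHyperplane a (onLine ∘ sel)

    baseBlocking : ∀ a → ¬ IsZero a → ∃ (Spanning a)
    baseBlocking a a≉0 with IsZero? (take 2 a) | IsZero? (drop 2 a)
    ... | yes A≈0 | yes B≈0 = ⊥-elim (a≉0 λ { 0F → A≈0 0F ; 1F → A≈0 1F ; 2F → B≈0 0F ; 3F → B≈0 1F })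
    ... | yes A≈0 | no B≉0 =
      let t , BP≈0 = linePoint-∈-kernel (drop 2 a)
      in (0F , zero) ∷ (0F , suc zeroIndex) ∷ (1F , t) ∷ [] , SpansHyperplane-cong {a = a}
           (SpansHyperplane-upper-zero {a} {t} A≈0 B≉0 BP≈0)
           (λ { 0F → ≋-refl ; 1F → λ { 0F → sym (linePoint-e₁ 0F) ; 1F → refl ; 2F → refl ; 3F → refl } ; 2F → ≋-refl })
    ... | no A≉0 | yes B≈0 =
      let t , AP≈0 = linePoint-∈-kernel (take 2 a)
      in (1F , zero) ∷ (1F , suc zeroIndex) ∷ (0F , t) ∷ [] , SpansHyperplane-cong {a = a}
           (SpansHyperplane-lower-zero {a} {t} A≉0 B≈0 AP≈0)
           (λ { 0F → ≋-refl ; 1F → λ { 0F → refl ; 1F → refl ; 2F → sym (linePoint-e₁ 0F) ; 3F → refl } ; 2F → ≋-refl })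
    ... | no A≉0 | no B≉0 =
      let t , AP≈0 = linePoint-∈-kernel (take 2 a)
          t′ , BP′≈0 = linePoint-∈-kernel (drop 2 a)
          L , s , Aw+Bw≈0 , Bw≉0 = thirdPoint A≉0 B≉0
      in (0F , t) ∷ (1F , t′) ∷ (L , s) ∷ [] , SpansHyperplane-cong {a = a}
           (SpansHyperplane-transversal {a} {t} {t′} {line↑ L (linePoint s)} {line↓ L (linePoint s)} A≉0 B≉0 AP≈0 BP′≈0 Aw+Bw≈0 Bw≉0)
           (λ { 0F → ≋-refl ; 1F → ≋-refl ; 2F → ≋-refl })

    basePoint : Fin (4 Nat.* Q) → Vector Carrier 4
    basePoint = onLine ∘ remQuot Q

    basePoint-combine : ∀ L t → basePoint (combine L t) ≋ onLine (L , t)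
    basePoint-combine L t = ≋-reflexive (≡.cong onLine (remQuot-combine L t))

    basePoint-injective : ∀ {k l} → Proportional (basePoint k) (basePoint l) → k ≡ l
    basePoint-injective {k} {l} p = remQuot-injective Q (onLine-injective {remQuot Q k} {remQuot Q l} p)

    frame : ∀ i → ∃ λ k → basePoint k ≋ basis i
    frame 0F = combine {4} {Q} 0F zero , ≋-trans (basePoint-combine 0F zero) λ { 0F → refl ; 1F → refl ; 2F → refl ; 3F → refl }
    frame 1F = combine {4} {Q} 0F (suc zeroIndex) , ≋-trans (basePoint-combine 0F (suc zeroIndex))
      λ { 0F → linePoint-e₁ 0F ; 1F → refl ; 2F → refl ; 3F → refl }
    frame 2F = combine {4} {Q} 1F zero , ≋-trans (basePoint-combine 1F zero) λ { 0F → refl ; 1F → refl ; 2F → refl ; 3F → refl }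
    frame 3F = combine {4} {Q} 1F (suc zeroIndex) , ≋-trans (basePoint-combine 1F (suc zeroIndex))
      λ { 0F → refl ; 1F → refl ; 2F → linePoint-e₁ 0F ; 3F → refl }

    base : FramedBlockingSet 3 (4 Nat.* Q)
    base = record
      { point           = basePoint
      ; point-nonzero   = onLine-nonzero ∘ remQuot Q
      ; point-injective = basePoint-injective
      ; basis-point     = frame
      ; blocking        = λ a a≉0 →
          let sel , spans = baseBlocking a a≉0
          in uncurry combine ∘ sel , SpansHyperplane-cong {a = a} spans
               (λ j → ≋-sym (basePoint-combine (proj₁ (sel j)) (proj₂ (sel j))))
      }

  framedBlockingSet : ∀ m → FramedBlockingSet (3 Nat.+ m) (blockingSize (suc r) (3 Nat.+ m))
  framedBlockingSet zero =
    let κ , κ-spec = ∃-nonvalue-t²-t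
    in ≡.subst (FramedBlockingSet 3) (≡.sym (blockingSize-3 r)) (BaseCase.base κ κ-spec)
  framedBlockingSet (suc m) =
    ≡.subst (FramedBlockingSet (4 Nat.+ m)) (≡.sym (blockingSize-suc r m)) (Extension.extension (framedBlockingSet m))

  module _ (v : ℕ) where
    open PG F v using (Σ⟨_⟩; PointSet; IsVFoldStrongBlockingSet)

    Σ⟨⟩≈sum : ∀ {n} (f : Vector Carrier n) → Σ⟨ f ⟩ ≈ sum f
    Σ⟨⟩≈sum {zero}  f = refl
    Σ⟨⟩≈sum {suc n} f = +-congˡ (Σ⟨⟩≈sum (tail f))

    toStrongBlockingSet : ∀ {N} → FramedBlockingSet v N → ∃ λ (B : PointSet N) → IsVFoldStrongBlockingSet B
    toStrongBlockingSet {N} S = B , λ a a≉0 →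
      let sel , spansHyperplane inHyperplane spans = blocking a a≉0
      in sel , (λ j → trans (Σ⟨⟩≈sum (λ i → a i * point (sel j) i)) (inHyperplane j)) , λ x ax≈0 →
           let coef , x≈ = spans x (trans (sym (Σ⟨⟩≈sum (λ i → a i * x i))) ax≈0)
           in coef , λ i → trans (x≈ i) (sym (Σ⟨⟩≈sum (λ j → coef j * point (sel j) i)))
      where
      open FramedBlockingSet S
      B : PointSet N
      B = record { pt = point ; nonzero = point-nonzero ; distinct = λ k l k≢l p → k≢l (point-injective p) }

corollary5 : ∀ {c ℓ : Level} (q : ℕ) → PrimePower q → (F : FiniteField c ℓ q) →
    (v : ℕ) → 3 ≤ v →
    ∃ λ (B : PG.PointSet F v (blockingSize q v)) → PG.IsVFoldStrongBlockingSet F v B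
corollary5 zero _ F _ _ with () ← proj₁ (FiniteField.enum-surj F (FiniteField.0# F))
corollary5 (suc r) _ F (suc (suc (suc m))) (s≤s (s≤s (s≤s z≤n))) =
  Construction.toStrongBlockingSet F (3 Nat.+ m) (Construction.framedBlockingSet F m)
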